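{- Let $(\hat\tau,\vec\tau,\overleftarrow{\tau})$ be a conservative translation from a logic $\mathcal{L}''$ to a logic $\mathcal{L}'$ and let $\varphi''\in F_{\mathcal{L}''}$. Then $\models_{\mathcal{L}''\sqcup\mathcal{L}'}\varphi''$ implies $\models_{\mathcal{L}''}\varphi''$.
   Context: Each logic $\mathcal{L}$ has a signature $(C_{\mathcal{L},n})_{n\in\mathbb{N}}$, a denumerable set $P_{\mathcal{L}}$ of propositional symbols, a set $F_{\mathcal{L}}$ of formulas, a class $\mathcal{M}_{\mathcal{L}}$ of models and a satisfaction relation $\Vdash_{\mathcal{L}}\subseteq\mathcal{M}_{\mathcal{L}}\times F_{\mathcal{L}}$; $\models_{\mathcal{L}}\varphi$ means $M\Vdash_{\mathcal{L}}\varphi$ for all $M\in\mathcal{M}_{\mathcal{L}}$. $\mathcal{A}_{\mathcal{L}}$ is the collection of maps generated from $c^\bullet(\varphi_1,\dots,\varphi_n)=c(\varphi_1,\dots,\varphi_n)$ (0-ary constructors and propositional symbols as 0-argument maps) by composition, aggregation and projections. A constructor translation is an injective $\hat\tau:C_{\mathcal{L}''}\cup P_{\mathcal{L}''}\to\mathcal{A}_{\mathcal{L}'}$ sending $n$-ary constructors to $n$-argument maps, propositional symbols to 0-argument maps, 0-ary constructors to $c'^\bullet$ with $c'\in C_{\mathcal{L}',0}$, and such that for all $p'',q''\in P_{\mathcal{L}''}$ there are $p',q'\in P_{\mathcal{L}'}$ with $p'$ occurring in $\hat\tau(p'')$ and $\hat\tau(q'')$ obtained from $\hat\tau(p'')$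 replacing $p'$ by $q'$. Its formula translation $\tau:F_{\mathcal{L}''}\to F_{\mathcal{L}'}$ is $\tau(c'')=\hat\tau(c'')$ for $c''\in C_{\mathcal{L}'',0}\cup P_{\mathcal{L}''}$ and $\tau(c''(\varphi_1,\dots,\varphi_n))=\hat\tau(c'')(\tau(\varphi_1),\dots,\tau(\varphi_n))$. A conservative translation is a triple $(\hat\tau,\vec\tau,\overleftarrow{\tau})$ with $\hat\tau$ a constructor translation, $\vec\tau:\mathcal{M}_{\mathcal{L}''}\to\mathcal{M}_{\mathcal{L}'}$, $\overleftarrow{\tau}:\mathcal{M}_{\mathcal{L}'}\to\mathcal{M}_{\mathcal{L}''}$, such that for all $M''\in\mathcal{M}_{\mathcal{L}''}$, $M'\in\mathcal{M}_{\mathcal{L}'}$, $\varphi''\in F_{\mathcal{L}''}$: $\vec\tau(M'')\Vdash_{\mathcal{L}'}\tau(\varphi'')$ implies $M''\Vdash_{\mathcal{L}''}\varphi''$, and $\overleftarrow{\tau}(M')\Vdash_{\mathcal{L}''}\varphi''$ implies $M'\Vdash_{\mathcal{L}'}\tau(\varphi'')$. $\tau$-identified symbols ($\hat\tau(c'')=c'^\bullet$) share the same name and are exactly the shared symbols. The coexistent combination $\mathcal{L}''\sqcup\mathcal{L}'$ has propositional symbols $P_{\mathcal{L}'}$, constructors $C_0=C_{\mathcal{L}'',0}\cup C_{\mathcal{L}',0}\cup(P_{\mathcal{L}''}\setminus P_{\mathcal{L}'})$, $C_n=C_{\mathcal{L}'',n}\cup C_{\mathcal{L}',n}$, models $\mathcal{M}_{\mathcal{L}'}$,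 and satisfaction $M'\Vdash_{\mathcal{L}''\sqcup\mathcal{L}'}\varphi$ iff $M'\Vdash_{\mathcal{L}'}\tau_\sqcup(\varphi)$, where $\tau_\sqcup:F_{\mathcal{L}''\sqcup\mathcal{L}'}\to F_{\mathcal{L}'}$ is: $\tau_\sqcup(c'')=\hat\tau(c'')$ for $c''\in C_{\mathcal{L}'',0}\cup P_{\mathcal{L}''}$; $\tau_\sqcup(c')=c'$ for $c'\in C_{\mathcal{L}',0}\cup P_{\mathcal{L}'}$; $\tau_\sqcup(c''(\varphi_1,\dots,\varphi_n))=\hat\tau(c'')(\tau_\sqcup(\varphi_1),\dots,\tau_\sqcup(\varphi_n))$ for $c''\in C_{\mathcal{L}'',n}$; $\tau_\sqcup(c'(\varphi_1,\dots,\varphi_n))=c'(\tau_\sqcup(\varphi_1),\dots,\tau_\sqcup(\varphi_n))$ for $c'\in C_{\mathcal{L}',n}$. -}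

module Defs where

open import Data.Nat using (ℕ; zero; suc)
open import Data.Fin using (Fin) renaming (zero to fzero; suc to fsuc)
open import Data.Vec using (Vec; []; _∷_; tabulate)
open import Data.Sum using (_⊎_; inj₁; inj₂)
open import Data.Product using (Σ; ∃; _,_; _×_)
open import Relation.Binary.PropositionalEquality using (_≡_)
open import Relation.Nullary using (¬_)
open import Function.Bundles using (_↔_)
open import Function.Definitions using (Injective)

-- The n-argument maps of
-- A_L (generated from the c^• by composition, aggregation and
-- projections) are exactly the terms with n variables (variables =
-- projections), acting on formulas by substitution.

data Term (C : ℕ → Set) (P : Set) (n : ℕ) : Set where
  var  : Fin n → Term C P n
  prop : P → Term C P n
  con  : ∀ {k} → C k → Vec (Term C P n) k → Term C P n

module _ {C : ℕ → Set} {P : Set} where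

  mutual
    subst : ∀ {n m} → Term C P n → Vec (Term C P m) n → Term C P m
    subst (var i)     σ = lookupV σ i
    subst (prop p)    σ = prop p
    subst (con c ts)  σ = con c (substs ts σ)

    substs : ∀ {n m k} → Vec (Term C P n) k → Vec (Term C P m) n → Vec (Term C P m) k
    substs []       σ = []
    substs (t ∷ ts) σ = subst t σ ∷ substs ts σ

    lookupV : ∀ {m n} → Vec (Term C P m) n → Fin n → Term C P m
    lookupV (x ∷ xs) fzero    = x
    lookupV (x ∷ xs) (fsuc i) = lookupV xs i

  _• : ∀ {n} → C n → Term C P n
  c • = con c (tabulate var)

  mutual
    data _occursIn_ (p : P) {n : ℕ} : Term C P n → Set where
      here : p occursIn prop p
      there : ∀ {k} {c : C k} {ts} → p occursInVec ts → p occursIn con c ts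

    data _occursInVec_ (p : P) {n : ℕ} : ∀ {k} → Vec (Term C P n) k → Set where
      hd : ∀ {k t} {ts : Vec _ k} → p occursIn t → p occursInVec (t ∷ ts)
      tl : ∀ {k t} {ts : Vec _ k} → p occursInVec ts → p occursInVec (t ∷ ts)

  mutual
    data Repl (p q : P) {n : ℕ} : Term C P n → Term C P n → Set where
      r-var   : ∀ i → Repl p q (var i) (var i)
      r-hit   : Repl p q (prop p) (prop q)
      r-miss  : ∀ r → ¬ (r ≡ p) → Repl p q (prop r) (prop r)
      r-con   : ∀ {k} (c : C k) {ts us} → ReplVec p q ts us → Repl p q (con c ts) (con c us)

    data ReplVec (p q : P) {n : ℕ} : ∀ {k} → Vec (Term C P n) k → Vec (Term C P n) k → Set where
      rv-[] : ReplVec p q [] []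
      rv-∷  : ∀ {k t u} {ts us : Vec _ k} → Repl p q t u → ReplVec p q ts us →
              ReplVec p q (t ∷ ts) (u ∷ us)

record Logic : Set₂ where
  field
    Con   : ℕ → Set
    Prop  : Set
    denum : Prop ↔ ℕ
    Model : Set₁
    _⊩_   : Model → Term Con Prop 0 → Set

  Form : Set
  Form = Term Con Prop 0

  ⊨_ : Form → Set₁
  ⊨ φ = (M : Model) → M ⊩ φ

open Logic

SymDom : Logic → ℕ → Set
SymDom L zero    = Con L 0 ⊎ Prop L
SymDom L (suc n) = Con L (suc n)

conSym : (L : Logic) → ∀ {n} → Con L n → SymDom L n
conSym L {zero}  c = inj₁ c
conSym L {suc n} c = c

Map : Logic → ℕ → Set
Map L n = Term (Con L) (Prop L) n

record ConstructorTranslation (L″ L′ : Logic) : Set where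
  field
    τ̂ : ∀ n → SymDom L″ n → Map L′ n
    injective : ∀ n → Injective _≡_ _≡_ (τ̂ n)
    nullary   : (c : Con L″ 0) → Σ (Con L′ 0) λ c′ → τ̂ 0 (inj₁ c) ≡ c′ •
    props     : (p″ q″ : Prop L″) → Σ (Prop L′) λ p′ → Σ (Prop L′) λ q′ →
                  (p′ occursIn τ̂ 0 (inj₂ p″)) × Repl p′ q′ (τ̂ 0 (inj₂ p″)) (τ̂ 0 (inj₂ q″))

  mutual
    tr : ∀ {n} → Term (Con L″) (Prop L″) n → Map L′ n
    tr (var i)    = var i
    tr (prop p)   = subst (τ̂ 0 (inj₂ p)) []
    tr (con c ts) = subst (τ̂ _ (conSym L″ c)) (trs ts)

    trs : ∀ {n k} → Vec (Term (Con L″) (Prop L″) n) k → Vec (Map L′ n) k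
    trs []       = []
    trs (t ∷ ts) = tr t ∷ trs ts

  τ : Form L″ → Form L′
  τ = tr

record ConservativeTranslation (L″ L′ : Logic) : Set₁ where
  field
    ctr : ConstructorTranslation L″ L′
  open ConstructorTranslation ctr public
  field
    fwd : Model L″ → Model L′
    bwd : Model L′ → Model L″
    fwd-cons : ∀ (M″ : Model L″) (φ : Form L″) → _⊩_ L′ (fwd M″) (τ φ) → _⊩_ L″ M″ φ
    bwd-cons : ∀ (M′ : Model L′) (φ : Form L″) → _⊩_ L″ (bwd M′) φ → _⊩_ L′ M′ (τ φ)

module Coexistent {L″ L′ : Logic} (T : ConservativeTranslation L″ L′) where
  open ConservativeTranslation T

  Con⊔ : ℕ → Set
  Con⊔ zero    = Con L″ 0 ⊎ Con L′ 0 ⊎ Prop L″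
  Con⊔ (suc n) = Con L″ (suc n) ⊎ Con L′ (suc n)

  inL″ : ∀ {n} → Con L″ n → Con⊔ n
  inL″ {zero}  c = inj₁ c
  inL″ {suc n} c = inj₁ c

  F⊔ : Set
  F⊔ = Term Con⊔ (Prop L′) 0

  mutual
    τ⊔ : ∀ {n} → Term Con⊔ (Prop L′) n → Map L′ n
    τ⊔ (var i)                        = var i
    τ⊔ (prop p′)                      = prop p′
    τ⊔ (con {zero} (inj₁ c″) ts)        = subst (τ̂ 0 (inj₁ c″)) (τ⊔s ts)
    τ⊔ (con {zero} (inj₂ (inj₁ c′)) ts) = con c′ (τ⊔s ts)
    τ⊔ (con {zero} (inj₂ (inj₂ p″)) ts) = subst (τ̂ 0 (inj₂ p″)) (τ⊔s ts)
    τ⊔ (con {suc n} (inj₁ c″) ts)       = subst (τ̂ (suc n) c″) (τ⊔s ts)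
    τ⊔ (con {suc n} (inj₂ c′) ts)       = con c′ (τ⊔s ts)

    τ⊔s : ∀ {n k} → Vec (Term Con⊔ (Prop L′) n) k → Vec (Map L′ n) k
    τ⊔s []       = []
    τ⊔s (t ∷ ts) = τ⊔ t ∷ τ⊔s ts

  combination : Logic
  combination = record
    { Con   = Con⊔
    ; Prop  = Prop L′
    ; denum = denum L′
    ; Model = Model L′
    ; _⊩_   = λ M′ φ → _⊩_ L′ M′ (τ⊔ φ)
    }

  mutual
    embed : ∀ {n} → Term (Con L″) (Prop L″) n → Term Con⊔ (Prop L′) n
    embed (var i)    = var i
    embed (prop p″)  = con {k = 0} (inj₂ (inj₂ p″)) []
    embed (con c ts) = con (inL″ c) (embeds ts)

    embeds : ∀ {n k} → Vec (Term (Con L″) (Prop L″) n) k → Vec (Term Con⊔ (Prop L′) n) k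
    embeds []       = []
    embeds (t ∷ ts) = embed t ∷ embeds ts

{-# OPTIONS --safe #-}
module Submission where

-- On formulas of L″ the translation τ⊔ underlying L″ ⊔ L′ is just τ, so validity of φ″ in the
-- combination says that τ φ″ holds in every model of L′, in particular in every image fwd M″;
-- conservativity of the forward model map then pulls φ″ back to M″.

open import Defs
open import Data.Nat using (suc)
open import Data.Vec using (Vec; []; _∷_)
open import Function using (_∘_)
open import Relation.Binary.PropositionalEquality as ≡ using (_≡_; refl; cong; cong₂)

module _ {L″ L′ : Logic} (T : ConservativeTranslation L″ L′) where
  open ConservativeTranslation T
  open Coexistent T

  mutual
    τ⊔-embed : ∀ {n} (t : Term (Logic.Con L″) (Logic.Prop L″) n) → τ⊔ (embed t) ≡ tr t
    τ⊔-embed (var i)            = refl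
    τ⊔-embed (prop p″)          = refl
    τ⊔-embed (con {0} c [])     = refl
    τ⊔-embed (con {suc k} c ts) = cong (subst (τ̂ (suc k) c)) (τ⊔s-embeds ts)

    τ⊔s-embeds : ∀ {n k} (ts : Vec (Term (Logic.Con L″) (Logic.Prop L″) n) k) →
                 τ⊔s (embeds ts) ≡ trs ts
    τ⊔s-embeds []       = refl
    τ⊔s-embeds (t ∷ ts) = cong₂ _∷_ (τ⊔-embed t) (τ⊔s-embeds ts)

  ⊨⊔-embed⇒⊨τ : (φ″ : Logic.Form L″) →
                Logic.⊨_ combination (embed φ″) → Logic.⊨_ L′ (τ φ″)
  ⊨⊔-embed⇒⊨τ φ″ valid M′ = ≡.subst (Logic._⊩_ L′ M′) (τ⊔-embed φ″) (valid M′)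

  ⊨τ⇒⊨ : (φ″ : Logic.Form L″) → Logic.⊨_ L′ (τ φ″) → Logic.⊨_ L″ φ″
  ⊨τ⇒⊨ φ″ valid M″ = fwd-cons M″ φ″ (valid (fwd M″))

mainTheorem8 : (L″ L′ : Logic) (T : ConservativeTranslation L″ L′) (φ″ : Logic.Form L″) →
    Logic.⊨_ (Coexistent.combination T) (Coexistent.embed T φ″) → Logic.⊨_ L″ φ″
mainTheorem8 L″ L′ T φ″ = ⊨τ⇒⊨ T φ″ ∘ ⊨⊔-embed⇒⊨τ T φ″
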